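{- Let $G$ be a $4$-critical graph with no $(7,2)$-colouring such that $D_3(G)$ contains no odd cycle, and let $v$ be a vertex with $N(v)=\{x,y,z\}$. Then for every pair of distinct $w,t\in\{x,y,z\}$, either $wt\in E(G)$ or there is a vertex $x_{w,t}\ne v$ adjacent to both $w$ and $t$. Moreover, these vertices can be chosen so that for distinct non-adjacent pairs $\{w,t\}\ne\{w',t'\}$ in $\{x,y,z\}$ we have $x_{w,t}\ne x_{w',t'}$.
   Context: A graph is $4$-critical if its chromatic number is $4$ but every proper subgraph is $3$-colourable. A $(7,2)$-colouring is a map $f:V(G)\to\{0,\dots,6\}$ with $2\le|f(a)-f(b)|\le5$ for every edge $ab$. $D_3(G)$ is the subgraph induced by the vertices of degree $3$. -}

module Defs where

open import Data.Nat using (ℕ; zero; suc; _≤_; _∸_; ∣_-_∣)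
open import Data.Nat using (_%_)
open import Data.Fin using (Fin; toℕ; inject₁; fromℕ)
import Data.Fin as Fin
open import Data.Bool using (Bool; true; false)
open import Data.List using (length; filterᵇ; allFin)
open import Data.Product using (Σ; _×_; ∃)
open import Data.Sum using (_⊎_)
open import Relation.Nullary using (¬_)
open import Relation.Binary.PropositionalEquality using (_≡_; _≢_)
open import Function.Definitions using (Injective)

record Graph (n : ℕ) : Set where
  field
    adj   : Fin n → Fin n → Bool
    sym   : ∀ a b → adj a b ≡ adj b a
    irrefl : ∀ a → adj a a ≡ false
open Graph public

record Subgraph {n : ℕ} (G : Graph n) : Set where
  field
    keep  : Fin n → Bool
    eadj  : Fin n → Fin n → Bool
    esym  : ∀ a b → eadj a b ≡ eadj b a
    esub  : ∀ a b → eadj a b ≡ true → adj G a b ≡ true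
    eleft : ∀ a b → eadj a b ≡ true → keep a ≡ true
open Subgraph public

IsProper : ∀ {n} {G : Graph n} → Subgraph G → Set
IsProper {n} {G} H =
  (Σ (Fin n) λ a → keep H a ≡ false) ⊎
  (Σ (Fin n) λ a → Σ (Fin n) λ b → adj G a b ≡ true × eadj H a b ≡ false)

Colourable : ∀ {n} → ℕ → Graph n → Set
Colourable {n} k G =
  Σ (Fin n → Fin k) λ c → ∀ a b → adj G a b ≡ true → c a ≢ c b

-- proper k-colouring of a subgraph (colours on deleted vertices are irrelevant)
SubColourable : ∀ {n} {G : Graph n} → ℕ → Subgraph G → Set
SubColourable {n} k H =
  Σ (Fin n → Fin k) λ c → ∀ a b → eadj H a b ≡ true → c a ≢ c b

ChromaticNumber : ∀ {n} → Graph n → ℕ → Set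
ChromaticNumber G k =
  Colourable k G × (∀ j → suc j ≤ k → ¬ Colourable j G)

Critical : ∀ {n} → ℕ → Graph n → Set
Critical k G =
  ChromaticNumber G k × (∀ (H : Subgraph G) → IsProper H → SubColourable (k ∸ 1) H)

Colouring72 : ∀ {n} → Graph n → Set
Colouring72 {n} G =
  Σ (Fin n → Fin 7) λ f → ∀ a b → adj G a b ≡ true →
    2 ≤ ∣ toℕ (f a) - toℕ (f b) ∣ × ∣ toℕ (f a) - toℕ (f b) ∣ ≤ 5

degree : ∀ {n} → Graph n → Fin n → ℕ
degree {n} G v = length (filterᵇ (adj G v) (allFin n))

-- An odd cycle of G all of whose vertices have degree 3, i.e. an odd cycle in D_3(G)
-- (D_3(G) is an induced subgraph, so its edges are exactly the G-edges between its vertices).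
OddCycleInD3 : ∀ {n} → Graph n → Set
OddCycleInD3 {n} G =
  Σ ℕ λ m → Σ (Fin (suc m) → Fin n) λ c →
    3 ≤ suc m × suc m % 2 ≡ 1 × Injective _≡_ _≡_ c ×
    (∀ (i : Fin m) → adj G (c (inject₁ i)) (c (Fin.suc i)) ≡ true) ×
    adj G (c (fromℕ m)) (c Fin.zero) ≡ true ×
    (∀ i → degree G (c i) ≡ 3)

{-# OPTIONS --safe #-}
-- Deleting v leaves a 3-colourable graph (criticality); a 3-colouring ψ of G − v must give
-- x, y, z three different colours, for otherwise a colour is free at v and G would be
-- 3-colourable. If two of them, a and b, had no common neighbour besides v, the vertices
-- could be shaded v ↦ 5, a ↦ 0, b ↦ 3, the rest of the colour class of a ↦ 6, of b ↦ 4,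
-- and the class of the third neighbour c ↦ 2 or 1 according as the vertex is adjacent to a
-- or not; this is a (7,2)-colouring. So a common neighbour p ≠ v of a and b exists; it sees
-- the colours of a and b, hence has the colour of c and is not adjacent to c. Thus the
-- chosen p_ab is non-adjacent to c while p_ac and p_bc are adjacent to c, which makes the
-- three witnesses distinct.
module Submission where

open import Data.Nat using (ℕ; suc; _≤_; _≤?_; ∣_-_∣)
open import Data.Nat.Properties using (≤-refl; ∣-∣-comm)
open import Data.Fin using (Fin; zero; suc; toℕ; #_)
open import Data.Fin.Properties using (_≟_; any?; punchOut-injective)
open import Data.Bool using (Bool; true; false; not; _∧_)
open import Data.Bool.Properties using (∧-comm; ∧-conicalˡ; ∧-conicalʳ; not-¬; ¬-not)
  renaming (_≟_ to _≟ᵇ_)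
open import Data.Unit using (tt)
open import Data.Empty using (⊥-elim)
open import Data.Product using (Σ; ∃; _×_; _,_; -,_; proj₁; proj₂)
open import Data.Sum using (_⊎_; inj₁; inj₂; [_,_]′)
import Data.Sum as Sum
open import Function using (_∘_)
open import Relation.Nullary using (¬_; Dec; yes; no; does; ¬?; _×-dec_)
open import Relation.Nullary.Decidable using (True; toWitness; fromWitness; dec-true; dec-false)
open import Relation.Binary.PropositionalEquality
  using (_≡_; _≢_; refl; sym; trans; cong; cong₂; subst; ≢-sym)
open import Defs hiding (sym)

variable
  n k : ℕ
  u w v a b c p q t : Fin n

fin3-avoid : (i j : Fin 3) → ∃ λ l → l ≢ i × l ≢ j
fin3-avoid zero             zero             = # 1 , (λ ()) , (λ ())
fin3-avoid zero             (suc zero)       = # 2 , (λ ()) , (λ ())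
fin3-avoid zero             (suc (suc zero)) = # 1 , (λ ()) , (λ ())
fin3-avoid (suc zero)       zero             = # 2 , (λ ()) , (λ ())
fin3-avoid (suc zero)       (suc zero)       = # 0 , (λ ()) , (λ ())
fin3-avoid (suc zero)       (suc (suc zero)) = # 0 , (λ ()) , (λ ())
fin3-avoid (suc (suc zero)) zero             = # 1 , (λ ()) , (λ ())
fin3-avoid (suc (suc zero)) (suc zero)       = # 0 , (λ ()) , (λ ())
fin3-avoid (suc (suc zero)) (suc (suc zero)) = # 0 , (λ ()) , (λ ())

fin2-≢-same⇒≡ : ∀ {i j l : Fin 2} → i ≢ l → j ≢ l → i ≡ j
fin2-≢-same⇒≡ {zero}     {zero}                 _   _   = refl
fin2-≢-same⇒≡ {suc zero} {suc zero}             _   _   = refl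
fin2-≢-same⇒≡ {zero}     {suc zero} {zero}      i≢l _   = ⊥-elim (i≢l refl)
fin2-≢-same⇒≡ {zero}     {suc zero} {suc zero}  _   j≢l = ⊥-elim (j≢l refl)
fin2-≢-same⇒≡ {suc zero} {zero}     {zero}      _   j≢l = ⊥-elim (j≢l refl)
fin2-≢-same⇒≡ {suc zero} {zero}     {suc zero}  i≢l _   = ⊥-elim (i≢l refl)

-- punchOut identifies Fin 3 ∖ {i} with Fin 2, in which l and k both avoid the image of j.
fin3-cover : ∀ {i j k : Fin 3} → i ≢ j → i ≢ k → j ≢ k → ∀ l → l ≡ i ⊎ l ≡ j ⊎ l ≡ k
fin3-cover {i} {j} {k} i≢j i≢k j≢k l with l ≟ i | l ≟ j
... | yes l≡i | _       = inj₁ l≡i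
... | no _    | yes l≡j = inj₂ (inj₁ l≡j)
... | no l≢i  | no l≢j  = inj₂ (inj₂ (punchOut-injective i≢l i≢k
      (fin2-≢-same⇒≡ (l≢j ∘ punchOut-injective i≢l i≢j) (≢-sym j≢k ∘ punchOut-injective i≢k i≢j))))
  where
  i≢l : i ≢ l
  i≢l = ≢-sym l≢i

Separated : Fin 7 → Fin 7 → Set
Separated i j = 2 ≤ ∣ toℕ i - toℕ j ∣ × ∣ toℕ i - toℕ j ∣ ≤ 5

separated? : ∀ i j → Dec (Separated i j)
separated? i j = 2 ≤? ∣ toℕ i - toℕ j ∣ ×-dec ∣ toℕ i - toℕ j ∣ ≤? 5

separated-sym : ∀ {i j} → Separated i j → Separated j i
separated-sym {i} {j} = subst (λ d → 2 ≤ d × d ≤ 5) (∣-∣-comm (toℕ i) (toℕ j))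

module _ (G : Graph n) where

  Adj : Fin n → Fin n → Set
  Adj u w = adj G u w ≡ true

  adj-sym : Adj u w → Adj w u
  adj-sym {u} {w} = trans (Graph.sym G w u)

  adj-irrefl : Adj u w → u ≢ w
  adj-irrefl {u} e refl = not-¬ e (irrefl G u)

  non-neighbour≢neighbour : adj G p t ≡ false → Adj q t → p ≢ q
  non-neighbour≢neighbour p≁t q~t refl = not-¬ q~t p≁t

  NeighboursAmong : Fin n → Fin n → Fin n → Fin n → Set
  NeighboursAmong v a b c = ∀ u → Adj v u → u ≡ a ⊎ u ≡ b ⊎ u ≡ c

  neighboursAmong-swap : NeighboursAmong v a b c → NeighboursAmong v a c b
  neighboursAmong-swap N u e = Sum.map₂ Sum.swap (N u e)

  neighboursAmong-rotate : NeighboursAmong v a b c → NeighboursAmong v b c a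
  neighboursAmong-rotate N u e = [ inj₂ ∘ inj₂ , Sum.map₂ inj₁ ]′ (N u e)

  CommonNeighbourExcept : Fin n → Fin n → Fin n → Fin n → Set
  CommonNeighbourExcept v a b p = p ≢ v × Adj p a × Adj p b

  commonNeighbourExcept? : ∀ v a b p → Dec (CommonNeighbourExcept v a b p)
  commonNeighbourExcept? v a b p =
    ¬? (p ≟ v) ×-dec (adj G p a ≟ᵇ true) ×-dec (adj G p b ≟ᵇ true)

  ProperExcept : Fin n → (Fin n → Fin k) → Set
  ProperExcept v ψ = ∀ {u w} → u ≢ v → w ≢ v → Adj u w → ψ u ≢ ψ w

  deleteVertex : Fin n → Subgraph G
  deleteVertex v = record
    { keep  = kept
    ; eadj  = λ p q → adj G p q ∧ (kept p ∧ kept q)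
    ; esym  = λ p q → cong₂ _∧_ (Graph.sym G p q) (∧-comm (kept p) (kept q))
    ; esub  = λ p q → ∧-conicalˡ (adj G p q) _
    ; eleft = λ p q e → ∧-conicalˡ (kept p) (kept q) (∧-conicalʳ (adj G p q) _ e)
    }
    where
    kept : Fin n → Bool
    kept p = not (does (p ≟ v))

  deleteVertex-keeps : u ≢ v → keep (deleteVertex v) u ≡ true
  deleteVertex-keeps {u} {v} u≢v = cong not (dec-false (u ≟ v) u≢v)

  deleteVertex-proper : IsProper (deleteVertex v)
  deleteVertex-proper {v} = inj₁ (v , cong not (dec-true (v ≟ v) refl))

  critical⇒¬colourable : Critical (suc k) G → ¬ Colourable k G
  critical⇒¬colourable {k} crit = proj₂ (proj₁ crit) k ≤-refl

  critical⇒properExcept : Critical (suc k) G → ∀ v → Σ (Fin n → Fin k) (ProperExcept v)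
  critical⇒properExcept crit v with proj₂ crit (deleteVertex v) deleteVertex-proper
  ... | ψ , proper = ψ , λ u≢v w≢v e →
    proper _ _ (cong₂ _∧_ e (cong₂ _∧_ (deleteVertex-keeps u≢v) (deleteVertex-keeps w≢v)))

  properExcept-extend : {ψ : Fin n → Fin k} → ProperExcept v ψ →
    (d : Fin k) → (∀ {w} → Adj v w → d ≢ ψ w) → Colourable k G
  properExcept-extend {v = v} {ψ = ψ} proper d free = colour , colour-proper
    where
    colour : Fin n → Fin _
    colour u with u ≟ v
    ... | yes _ = d
    ... | no _  = ψ u

    colour-proper : ∀ u w → Adj u w → colour u ≢ colour w
    colour-proper u w e with u ≟ v | w ≟ v
    ... | yes refl | yes refl = ⊥-elim (adj-irrefl e refl)
    ... | yes refl | no _     = free e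
    ... | no _     | yes refl = ≢-sym (free (adj-sym e))
    ... | no u≢v   | no w≢v   = proper u≢v w≢v e

  uncolourable⇒neighbours-distinct : ¬ Colourable 3 G → {ψ : Fin n → Fin 3} → ProperExcept v ψ →
    NeighboursAmong v a b c → ψ a ≢ ψ b
  uncolourable⇒neighbours-distinct {v} {a} {b} {c} ¬col {ψ} proper N ψa≡ψb
    with fin3-avoid (ψ a) (ψ c)
  ... | d , d≢ψa , d≢ψc = ¬col (properExcept-extend proper d free)
    where
    free : Adj v w → d ≢ ψ w
    free {w} e with N w e
    ... | inj₁ refl        = d≢ψa
    ... | inj₂ (inj₁ refl) = λ d≡ψb → d≢ψa (trans d≡ψb (sym ψa≡ψb))
    ... | inj₂ (inj₂ refl) = d≢ψc

  module ShadingWithoutCommonNeighbour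
    {v : Fin n} {ψ : Fin n → Fin 3} (proper : ProperExcept v ψ)
    {a b c : Fin n} (ψa≢ψb : ψ a ≢ ψ b) (ψa≢ψc : ψ a ≢ ψ c) (ψb≢ψc : ψ b ≢ ψ c)
    (N : NeighboursAmong v a b c) (no-common : ¬ ∃ (CommonNeighbourExcept v a b))
    where

    -- kA, kB are the colour classes of a and b without a and b; the class of c splits
    -- into kC⁺ (adjacent to a) and kC⁻ (not adjacent to a).
    data Kind : Set where
      kv ka kb kA kB kC⁺ kC⁻ : Kind

    shade : Kind → Fin 7
    shade kv  = # 5
    shade ka  = # 0
    shade kb  = # 3
    shade kA  = # 6
    shade kB  = # 4
    shade kC⁺ = # 2
    shade kC⁻ = # 1

    record ShadesSeparated (k l : Kind) : Set where
      constructor checked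
      field
        separation : True (separated? (shade k) (shade l))

    shadesSeparated-sym : ∀ {k l} → ShadesSeparated k l → ShadesSeparated l k
    shadesSeparated-sym {k} {l} (checked s) =
      checked (fromWitness (separated-sym {shade k} {shade l} (toWitness s)))

    data View (u : Fin n) : Kind → Set where
      at-v  : u ≡ v → View u kv
      at-a  : u ≢ v → u ≡ a → View u ka
      at-b  : u ≢ v → u ≡ b → View u kb
      in-A  : u ≢ v → u ≢ a → ψ u ≡ ψ a → View u kA
      in-B  : u ≢ v → u ≢ b → ψ u ≡ ψ b → View u kB
      in-C⁺ : u ≢ v → ψ u ≡ ψ c → Adj a u → View u kC⁺
      in-C⁻ : u ≢ v → ψ u ≡ ψ c → adj G a u ≡ false → View u kC⁻

    classify : ∀ u → ∃ (View u)
    classify u with u ≟ v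
    ... | yes u≡v = -, at-v u≡v
    ... | no u≢v with u ≟ a | u ≟ b | fin3-cover ψa≢ψb ψa≢ψc ψb≢ψc (ψ u)
    ...   | yes u≡a | _       | _                  = -, at-a u≢v u≡a
    ...   | no _    | yes u≡b | _                  = -, at-b u≢v u≡b
    ...   | no u≢a  | no _    | inj₁ ψu≡ψa         = -, in-A u≢v u≢a ψu≡ψa
    ...   | no _    | no u≢b  | inj₂ (inj₁ ψu≡ψb)  = -, in-B u≢v u≢b ψu≡ψb
    ...   | no _    | no _    | inj₂ (inj₂ ψu≡ψc) with adj G a u in a~u
    ...     | true  = -, in-C⁺ u≢v ψu≡ψc a~u
    ...     | false = -, in-C⁻ u≢v ψu≡ψc a~u

    same-class-nonadjacent : u ≢ v → w ≢ v → ψ u ≡ ψ t → ψ w ≡ ψ t → ¬ Adj u w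
    same-class-nonadjacent u≢v w≢v ψu≡ψt ψw≡ψt e = proper u≢v w≢v e (trans ψu≡ψt (sym ψw≡ψt))

    v-neighbour-coloured-a : Adj v w → ψ w ≡ ψ a → w ≡ a
    v-neighbour-coloured-a {w} e ψw≡ψa with N w e
    ... | inj₁ w≡a         = w≡a
    ... | inj₂ (inj₁ refl) = ⊥-elim (ψa≢ψb (sym ψw≡ψa))
    ... | inj₂ (inj₂ refl) = ⊥-elim (ψa≢ψc (sym ψw≡ψa))

    v-neighbour-coloured-b : Adj v w → ψ w ≡ ψ b → w ≡ b
    v-neighbour-coloured-b {w} e ψw≡ψb with N w e
    ... | inj₁ refl        = ⊥-elim (ψa≢ψb ψw≡ψb)
    ... | inj₂ (inj₁ w≡b)  = w≡b
    ... | inj₂ (inj₂ refl) = ⊥-elim (ψb≢ψc (sym ψw≡ψb))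

    separated-from-v : ∀ {l} → View u kv → Adj u w → View w l → ShadesSeparated kv l
    separated-from-v (at-v refl) e (at-v refl)       = ⊥-elim (adj-irrefl e refl)
    separated-from-v _           _ (at-a _ _)        = checked tt
    separated-from-v _           _ (at-b _ _)        = checked tt
    separated-from-v (at-v refl) e (in-A _ w≢a ψw≡ψa) = ⊥-elim (w≢a (v-neighbour-coloured-a e ψw≡ψa))
    separated-from-v (at-v refl) e (in-B _ w≢b ψw≡ψb) = ⊥-elim (w≢b (v-neighbour-coloured-b e ψw≡ψb))
    separated-from-v _           _ (in-C⁺ _ _ _)     = checked tt
    separated-from-v _           _ (in-C⁻ _ _ _)     = checked tt

    separated-from-a : ∀ {l} → View u ka → Adj u w → View w l → ShadesSeparated ka l
    separated-from-a p e q@(at-v _) = shadesSeparated-sym (separated-from-v q (adj-sym e) p)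
    separated-from-a (at-a _ refl) e (at-a _ refl) = ⊥-elim (adj-irrefl e refl)
    separated-from-a _ _ (at-b _ _) = checked tt
    separated-from-a (at-a a≢v refl) e (in-A w≢v _ ψw≡ψa) =
      ⊥-elim (same-class-nonadjacent a≢v w≢v refl ψw≡ψa e)
    separated-from-a _ _ (in-B _ _ _) = checked tt
    separated-from-a _ _ (in-C⁺ _ _ _) = checked tt
    separated-from-a (at-a _ refl) e (in-C⁻ _ _ a≁w) = ⊥-elim (not-¬ e a≁w)

    separated-from-b : ∀ {l} → View u kb → Adj u w → View w l → ShadesSeparated kb l
    separated-from-b p e q@(at-v _)   = shadesSeparated-sym (separated-from-v q (adj-sym e) p)
    separated-from-b p e q@(at-a _ _) = shadesSeparated-sym (separated-from-a q (adj-sym e) p)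
    separated-from-b (at-b _ refl) e (at-b _ refl) = ⊥-elim (adj-irrefl e refl)
    separated-from-b _ _ (in-A _ _ _) = checked tt
    separated-from-b (at-b b≢v refl) e (in-B w≢v _ ψw≡ψb) =
      ⊥-elim (same-class-nonadjacent b≢v w≢v refl ψw≡ψb e)
    separated-from-b (at-b _ refl) e (in-C⁺ w≢v _ a~w) =
      ⊥-elim (no-common (-, w≢v , adj-sym a~w , adj-sym e))
    separated-from-b _ _ (in-C⁻ _ _ _) = checked tt

    separated-from-A : ∀ {l} → View u kA → Adj u w → View w l → ShadesSeparated kA l
    separated-from-A p e q@(at-v _)   = shadesSeparated-sym (separated-from-v q (adj-sym e) p)
    separated-from-A p e q@(at-a _ _) = shadesSeparated-sym (separated-from-a q (adj-sym e) p)
    separated-from-A p e q@(at-b _ _) = shadesSeparated-sym (separated-from-b q (adj-sym e) p)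
    separated-from-A (in-A u≢v _ ψu≡ψa) e (in-A w≢v _ ψw≡ψa) =
      ⊥-elim (same-class-nonadjacent u≢v w≢v ψu≡ψa ψw≡ψa e)
    separated-from-A _ _ (in-B _ _ _) = checked tt
    separated-from-A _ _ (in-C⁺ _ _ _) = checked tt
    separated-from-A _ _ (in-C⁻ _ _ _) = checked tt

    separated-from-B : ∀ {l} → View u kB → Adj u w → View w l → ShadesSeparated kB l
    separated-from-B p e q@(at-v _)     = shadesSeparated-sym (separated-from-v q (adj-sym e) p)
    separated-from-B p e q@(at-a _ _)   = shadesSeparated-sym (separated-from-a q (adj-sym e) p)
    separated-from-B p e q@(at-b _ _)   = shadesSeparated-sym (separated-from-b q (adj-sym e) p)
    separated-from-B p e q@(in-A _ _ _) = shadesSeparated-sym (separated-from-A q (adj-sym e) p)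
    separated-from-B (in-B u≢v _ ψu≡ψb) e (in-B w≢v _ ψw≡ψb) =
      ⊥-elim (same-class-nonadjacent u≢v w≢v ψu≡ψb ψw≡ψb e)
    separated-from-B _ _ (in-C⁺ _ _ _) = checked tt
    separated-from-B _ _ (in-C⁻ _ _ _) = checked tt

    separated-from-C⁺ : ∀ {l} → View u kC⁺ → Adj u w → View w l → ShadesSeparated kC⁺ l
    separated-from-C⁺ p e q@(at-v _)     = shadesSeparated-sym (separated-from-v q (adj-sym e) p)
    separated-from-C⁺ p e q@(at-a _ _)   = shadesSeparated-sym (separated-from-a q (adj-sym e) p)
    separated-from-C⁺ p e q@(at-b _ _)   = shadesSeparated-sym (separated-from-b q (adj-sym e) p)
    separated-from-C⁺ p e q@(in-A _ _ _) = shadesSeparated-sym (separated-from-A q (adj-sym e) p)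
    separated-from-C⁺ p e q@(in-B _ _ _) = shadesSeparated-sym (separated-from-B q (adj-sym e) p)
    separated-from-C⁺ (in-C⁺ u≢v ψu≡ψc _) e (in-C⁺ w≢v ψw≡ψc _) =
      ⊥-elim (same-class-nonadjacent u≢v w≢v ψu≡ψc ψw≡ψc e)
    separated-from-C⁺ (in-C⁺ u≢v ψu≡ψc _) e (in-C⁻ w≢v ψw≡ψc _) =
      ⊥-elim (same-class-nonadjacent u≢v w≢v ψu≡ψc ψw≡ψc e)

    separated-from-C⁻ : ∀ {l} → View u kC⁻ → Adj u w → View w l → ShadesSeparated kC⁻ l
    separated-from-C⁻ p e q@(at-v _)      = shadesSeparated-sym (separated-from-v q (adj-sym e) p)
    separated-from-C⁻ p e q@(at-a _ _)    = shadesSeparated-sym (separated-from-a q (adj-sym e) p)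
    separated-from-C⁻ p e q@(at-b _ _)    = shadesSeparated-sym (separated-from-b q (adj-sym e) p)
    separated-from-C⁻ p e q@(in-A _ _ _)  = shadesSeparated-sym (separated-from-A q (adj-sym e) p)
    separated-from-C⁻ p e q@(in-B _ _ _)  = shadesSeparated-sym (separated-from-B q (adj-sym e) p)
    separated-from-C⁻ p e q@(in-C⁺ _ _ _) = shadesSeparated-sym (separated-from-C⁺ q (adj-sym e) p)
    separated-from-C⁻ (in-C⁻ u≢v ψu≡ψc _) e (in-C⁻ w≢v ψw≡ψc _) =
      ⊥-elim (same-class-nonadjacent u≢v w≢v ψu≡ψc ψw≡ψc e)

    shades-separated : ∀ {k l} → View u k → Adj u w → View w l → ShadesSeparated k l
    shades-separated p@(at-v _)      = separated-from-v p
    shades-separated p@(at-a _ _)    = separated-from-a p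
    shades-separated p@(at-b _ _)    = separated-from-b p
    shades-separated p@(in-A _ _ _)  = separated-from-A p
    shades-separated p@(in-B _ _ _)  = separated-from-B p
    shades-separated p@(in-C⁺ _ _ _) = separated-from-C⁺ p
    shades-separated p@(in-C⁻ _ _ _) = separated-from-C⁻ p

    colouring72 : Colouring72 G
    colouring72 = shade ∘ kind , λ u w e →
      toWitness (ShadesSeparated.separation
        (shades-separated (proj₂ (classify u)) e (proj₂ (classify w))))
      where
      kind : Fin n → Kind
      kind u = proj₁ (classify u)

  common-neighbour-exists : ¬ Colouring72 G → {ψ : Fin n → Fin 3} → ProperExcept v ψ →
    ψ a ≢ ψ b → ψ a ≢ ψ c → ψ b ≢ ψ c → NeighboursAmong v a b c →
    ∃ (CommonNeighbourExcept v a b)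
  common-neighbour-exists {v} {a} {b} ¬72 proper ψa≢ψb ψa≢ψc ψb≢ψc N
    with any? (commonNeighbourExcept? v a b)
  ... | yes common = common
  ... | no none    =
    ⊥-elim (¬72 (ShadingWithoutCommonNeighbour.colouring72 proper ψa≢ψb ψa≢ψc ψb≢ψc N none))

  common-neighbour-misses-third : {ψ : Fin n → Fin 3} → ProperExcept v ψ →
    ψ a ≢ ψ b → ψ a ≢ ψ c → ψ b ≢ ψ c → Adj v a → Adj v b → Adj v c →
    CommonNeighbourExcept v a b p → ¬ Adj p c
  common-neighbour-misses-third {p = p} {ψ} proper ψa≢ψb ψa≢ψc ψb≢ψc va vb vc (p≢v , p~a , p~b) p~c
    with fin3-cover ψa≢ψb ψa≢ψc ψb≢ψc (ψ p)
  ... | inj₁ ψp≡ψa        = proper p≢v (≢-sym (adj-irrefl va)) p~a ψp≡ψa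
  ... | inj₂ (inj₁ ψp≡ψb) = proper p≢v (≢-sym (adj-irrefl vb)) p~b ψp≡ψb
  ... | inj₂ (inj₂ ψp≡ψc) = proper p≢v (≢-sym (adj-irrefl vc)) p~c ψp≡ψc

  exclusive-common-neighbour : Critical 4 G → ¬ Colouring72 G → NeighboursAmong v a b c →
    Adj v a → Adj v b → Adj v c →
    ∃ λ p → CommonNeighbourExcept v a b p × adj G p c ≡ false
  exclusive-common-neighbour {v} {a} {b} {c} crit ¬72 N va vb vc with critical⇒properExcept crit v
  ... | ψ , proper =
    proj₁ found , proj₂ found ,
    ¬-not (common-neighbour-misses-third proper ψa≢ψb ψa≢ψc ψb≢ψc va vb vc (proj₂ found))
    where
    ¬col : ¬ Colourable 3 G
    ¬col = critical⇒¬colourable crit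

    ψa≢ψb : ψ a ≢ ψ b
    ψa≢ψb = uncolourable⇒neighbours-distinct ¬col proper N

    ψa≢ψc : ψ a ≢ ψ c
    ψa≢ψc = uncolourable⇒neighbours-distinct ¬col proper (neighboursAmong-swap N)

    ψb≢ψc : ψ b ≢ ψ c
    ψb≢ψc = uncolourable⇒neighbours-distinct ¬col proper (neighboursAmong-rotate N)

    found : ∃ (CommonNeighbourExcept v a b)
    found = common-neighbour-exists ¬72 proper ψa≢ψb ψa≢ψc ψb≢ψc N

lemma7p2 : ∀ {n} (G : Graph n) → Critical 4 G → ¬ Colouring72 G → ¬ OddCycleInD3 G →
    ∀ (v x y z : Fin n) → x ≢ y → x ≢ z → y ≢ z →
    (∀ u → adj G v u ≡ true → (u ≡ x ⊎ u ≡ y ⊎ u ≡ z)) →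
    adj G v x ≡ true → adj G v y ≡ true → adj G v z ≡ true →
    Σ (Fin n) λ pxy → Σ (Fin n) λ pxz → Σ (Fin n) λ pyz →
      (adj G x y ≡ true ⊎ (pxy ≢ v × adj G pxy x ≡ true × adj G pxy y ≡ true)) ×
      (adj G x z ≡ true ⊎ (pxz ≢ v × adj G pxz x ≡ true × adj G pxz z ≡ true)) ×
      (adj G y z ≡ true ⊎ (pyz ≢ v × adj G pyz y ≡ true × adj G pyz z ≡ true)) ×
      (adj G x y ≡ false → adj G x z ≡ false → pxy ≢ pxz) ×
      (adj G x y ≡ false → adj G y z ≡ false → pxy ≢ pyz) ×
      (adj G x z ≡ false → adj G y z ≡ false → pxz ≢ pyz)
lemma7p2 G crit ¬72 _ v x y z _ _ _ N vx vy vz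
  with exclusive-common-neighbour G crit ¬72 N vx vy vz
     | exclusive-common-neighbour G crit ¬72 (neighboursAmong-swap G N) vx vz vy
     | exclusive-common-neighbour G crit ¬72 (neighboursAmong-rotate G N) vy vz vx
... | pxy , xy , pxy≁z | pxz , xz@(_ , pxz~x , pxz~z) , _ | pyz , yz@(_ , _ , pyz~z) , pyz≁x =
  pxy , pxz , pyz , inj₂ xy , inj₂ xz , inj₂ yz ,
  (λ _ _ → non-neighbour≢neighbour G pxy≁z pxz~z) ,
  (λ _ _ → non-neighbour≢neighbour G pxy≁z pyz~z) ,
  (λ _ _ → ≢-sym (non-neighbour≢neighbour G pyz≁x pxz~x))
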